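{- Let $w_1,\dots,w_k\in\mathbb{Z}$, $m$ a positive integer and $c\in\{0,\dots,m-1\}$. The mod set $M=\{(x_1,\dots,x_k)\in\mathbb{N}^k : \sum_{i=1}^k w_ix_i\equiv c \pmod m\}$ is reverse-robustly decidable by a chemical reaction decider (CRD).
   Context: A CRN is a pair $(\Lambda,R)$ with $\Lambda$ finite and reactions $r=(\vec a,\vec p)\in\mathbb{N}^\Lambda\times\mathbb{N}^\Lambda$; its reverse is $(\vec p,\vec a)$. Reaction $r$ is applicable to $\vec x\in\mathbb{N}^\Lambda$ if $\vec x\geqq\vec a$, yielding $\vec x-\vec a+\vec p$. $\vec x\to\vec y$: $\vec y$ obtained by finitely many forward reaction applications; $\vec x\looparrowright\vec y$: obtained by finitely many applications of reactions and/or their reverses. A CRD is $(\Lambda,R,\Sigma,\Upsilon_1,\Upsilon_0,\vec s)$ with input species $\Sigma=\{X_1,\dots,X_k\}$, yes voters $\Upsilon_1$, no voters $\Upsilon_0$, initial context $\vec s\in\mathbb{N}^{\Lambda\setminus\Sigma}$. Valid initial configurations are $\vec s$ plus arbitrary counts of input species, with input $\vec i|\Sigma\in\mathbb{N}^k$. Output $\Phi(\vec c)=1$ if some yes voter has positive count and no no voter does, $0$ if some no voter has positive count and no yes voter does, undefined otherwise; $\vec o$ is stable if $\Phi(\vec o')=\Phi(\vec o)$ for all $\vec o\to\vec o'$. The CRD reverse-robustly decides a set $S\subseteq\mathbb{N}^k$ if for every valid initial configuration $\vec i$ and every $\vec c$ with $\vec i\looparrowright\vec c$ there is a stable $\vec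 o$ with $\vec c\to\vec o$ and $\Phi(\vec o)=1$ iff $\vec i|\Sigma\in S$. -}

module Defs where

open import Data.Nat using (ℕ; zero; suc; _≤_; _<_; _∸_; _+_; _≤?_; _<?_)
open import Data.Integer as ℤ using (ℤ; +_)
open import Data.Integer.Divisibility using () renaming (_∣_ to _∣ℤ_)
open import Data.Fin using (Fin; zero; suc)
open import Data.Fin.Subset using (Subset; _∈_)
open import Data.Fin.Subset.Properties using (_∈?_)
open import Data.Fin.Properties using (any?)
open import Data.List using (List)
open import Data.List.Membership.Propositional using () renaming (_∈_ to _∈L_)
open import Data.Bool using (Bool; true; false)
open import Data.Maybe using (Maybe; just; nothing)
open import Data.Product using (Σ; ∃; ∃-syntax; _×_; _,_)
open import Data.Sum using (_⊎_)
open import Relation.Nullary using (¬_; does; _×-dec_)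
open import Relation.Binary.PropositionalEquality using (_≡_; _≢_)
open import Relation.Binary.Construct.Closure.ReflexiveTransitive using (Star)
open import Function.Definitions using (Injective)

Config : ℕ → Set
Config n = Fin n → ℕ

record Reaction (n : ℕ) : Set where
  constructor _⇒_
  field
    reactants : Config n
    products  : Config n
open Reaction public

reverse : ∀ {n} → Reaction n → Reaction n
reverse (a ⇒ p) = p ⇒ a

Applicable : ∀ {n} → Reaction n → Config n → Set
Applicable r x = ∀ s → reactants r s ≤ x s

Applies : ∀ {n} → Reaction n → Config n → Config n → Set
Applies r x y = Applicable r x × (∀ s → y s ≡ (x s ∸ reactants r s) + products r s)

Step : ∀ {n} → List (Reaction n) → Config n → Config n → Set
Step R x y = ∃[ r ] (r ∈L R × Applies r x y)

RevStep : ∀ {n} → List (Reaction n) → Config n → Config n → Set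
RevStep R x y = ∃[ r ] (r ∈L R × (Applies r x y ⊎ Applies (reverse r) x y))

Reach : ∀ {n} → List (Reaction n) → Config n → Config n → Set
Reach R = Star (Step R)

RevReach : ∀ {n} → List (Reaction n) → Config n → Config n → Set
RevReach R = Star (RevStep R)

record CRD (k : ℕ) : Set where
  field
    n          : ℕ
    reactions  : List (Reaction n)
    input      : Fin k → Fin n
    input-inj  : Injective _≡_ _≡_ input
    yesVoters  : Subset n
    noVoters   : Subset n
    context    : Config n              -- s (values on input species are ignored)

module _ {k : ℕ} (D : CRD k) where
  open CRD D

  ValidInit : (Fin k → ℕ) → Config n → Set
  ValidInit x i = (∀ j → i (input j) ≡ x j)
                × (∀ s → (∀ j → s ≢ input j) → i s ≡ context s)

  someYes : Config n → Bool
  someYes c = does (any? (λ s → (s ∈? yesVoters) ×-dec (0 <? c s)))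

  someNo : Config n → Bool
  someNo c = does (any? (λ s → (s ∈? noVoters) ×-dec (0 <? c s)))

  -- Output Φ (nothing = undefined)
  Φ : Config n → Maybe Bool
  Φ c with someYes c | someNo c
  ... | true  | false = just true
  ... | false | true  = just false
  ... | _     | _     = nothing

  Stable : Config n → Set
  Stable o = ∀ o' → Reach reactions o o' → Φ o' ≡ Φ o

  ReverseRobustlyDecides : ((Fin k → ℕ) → Set) → Set
  ReverseRobustlyDecides S =
    ∀ (x : Fin k → ℕ) (i : Config n) → ValidInit x i →
    ∀ (c : Config n) → RevReach reactions i c →
    ∃[ o ] (Reach reactions c o × Stable o
            × (S x → Φ o ≡ just true)
            × (¬ S x → Φ o ≡ just false))

weightedSum : ∀ {k} → (Fin k → ℤ) → (Fin k → ℕ) → ℤ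
weightedSum {zero}  w x = + 0
weightedSum {suc k} w x = w zero ℤ.* (+ x zero) ℤ.+ weightedSum (λ i → w (suc i)) (λ i → x (suc i))

ModSet : ∀ {k} → (Fin k → ℤ) → ℕ → ℕ → (Fin k → ℕ) → Set
ModSet w m c x = (+ m) ∣ℤ (weightedSum w x ℤ.- (+ c))

{-# OPTIONS --safe #-}
module Submission where

-- Besides the input species X_j the decider has a leader species L_r for every residue r mod m;
-- it starts with one leader in L_0, and its reactions are X_j + L_r → L_((r + w_j) mod m).
-- Every reaction, and every reverse reaction, keeps exactly one leader and preserves modulo m
-- the value  Σ_j w_j·#X_j + Σ_r r·#L_r,  which initially is Σ_j w_j x_j. Hence from any
-- configuration reachable by reversible steps, firing reactions until no input is left (each
-- firing consumes one) reaches a configuration whose only species is a leader L_r with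
-- r ≡ Σ_j w_j x_j (mod m). No reaction applies there, and since L_c is the only yes voter and
-- every other species votes no, it outputs yes exactly when r = c.

open import Defs
open import Data.Nat using (ℕ; zero; suc; _<_; _≤_; _<?_; z≤n; NonZero)
import Data.Nat.Properties as ℕP
open import Data.Nat.DivMod using (m<n⇒m%n≡m)
open import Data.Nat.Divisibility using (n∣m⇒m%n≡0)
open import Data.Integer using (ℤ; +_; _%ℕ_; _/ℕ_)
import Data.Integer.Properties as ℤP
open import Data.Integer.DivMod using (n%ℕd<d; a≡a%ℕn+[a/ℕn]*n)
open import Data.Integer.Divisibility.Signed
  using (_∣_; divides; ∣ᵤ⇒∣; ∣⇒∣ᵤ; ∣m⇒∣-m; ∣m∣n⇒∣m+n)
open import Data.Integer.Tactic.RingSolver using (solve-∀)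
open import Data.Fin using (Fin; zero; suc; toℕ; fromℕ<; _↑ˡ_; _↑ʳ_; splitAt)
open import Data.Fin.Properties
  using (any?; _≟_; toℕ<n; toℕ-injective; toℕ-fromℕ<; ↑ˡ-injective; ↑ʳ-injective;
         splitAt-↑ˡ; splitAt-↑ʳ; splitAt⁻¹-↑ˡ; splitAt⁻¹-↑ʳ)
open import Data.Fin.Subset using (Subset; _∈_; ∁; ⁅_⁆)
open import Data.Fin.Subset.Properties
  using (_∈?_; x∈p⇒x∉∁p; x∉p⇒x∈∁p; x∈⁅x⁆; x∈⁅y⁆⇒x≡y)
open import Data.Vec.Functional using (_++_; replicate)
open import Data.Vec.Functional.Properties using (lookup-++ˡ; lookup-++ʳ)
open import Algebra.Properties.CommutativeMonoid.Sum ℕP.+-0-commutativeMonoid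
  using (sum; ∑-distrib-+; sum-cong-≗; sum-replicate-zero)
open import Data.List using (List; cartesianProductWith; allFin)
open import Data.List.Membership.Propositional using () renaming (_∈_ to _∈L_)
open import Data.List.Membership.Propositional.Properties
  using (∈-cartesianProductWith⁺; ∈-cartesianProductWith⁻; ∈-allFin)
open import Data.Bool using (true; false; not)
open import Data.Maybe using (just)
open import Data.Empty using (⊥-elim)
open import Data.Product using (∃-syntax; _×_; _,_)
open import Data.Sum using (_⊎_; inj₁; inj₂)
open import Relation.Nullary using (¬_; yes; no; does; _×-dec_)
open import Relation.Nullary.Decidable using (dec-true; dec-false; does-⇔)
open import Relation.Binary.PropositionalEquality
open import Relation.Binary.Construct.Closure.ReflexiveTransitive using (ε; _◅_)
open import Function using (_∘_; id; _⇔_; mk⇔)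

module _ where
  open import Data.Nat using (_+_; _∸_)
  open import Algebra.Properties.CommutativeSemigroup ℕP.+-commutativeSemigroup
    using (xy∙z≈xz∙y)

  δ : ∀ {N} → Fin N → Fin N → ℕ
  δ zero    zero    = 1
  δ zero    (suc _) = 0
  δ (suc _) zero    = 0
  δ (suc i) (suc j) = δ i j

  δ-diag : ∀ {N} (i : Fin N) → δ i i ≡ 1
  δ-diag zero    = refl
  δ-diag (suc i) = δ-diag i

  δ-pos⇒≡ : ∀ {N} {i j : Fin N} → 0 < δ i j → i ≡ j
  δ-pos⇒≡ {i = zero}  {zero}  _ = refl
  δ-pos⇒≡ {i = suc i} {suc j} p = cong suc (δ-pos⇒≡ p)

  δ≤ : ∀ {N} (f : Fin N → ℕ) {i} → 0 < f i → ∀ j → δ i j ≤ f j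
  δ≤ f {zero}  pos zero    = pos
  δ≤ f {zero}  pos (suc j) = z≤n
  δ≤ f {suc i} pos zero    = z≤n
  δ≤ f {suc i} pos (suc j) = δ≤ (f ∘ suc) pos j

  sum-δ : ∀ {N} (i : Fin N) → sum (δ i) ≡ 1
  sum-δ {suc N} zero    = cong suc (sum-replicate-zero N)
  sum-δ         (suc i) = sum-δ i

  sum-balance : ∀ {N} {f g f′ g′ : Fin N → ℕ} → (∀ i → f i + g i ≡ f′ i + g′ i) →
                sum f + sum g ≡ sum f′ + sum g′
  sum-balance {f = f} {g} {f′} {g′} eq = begin
    sum f + sum g                 ≡⟨ ∑-distrib-+ f g ⟨
    sum (λ i → f i + g i)         ≡⟨ sum-cong-≗ eq ⟩
    sum (λ i → f′ i + g′ i)       ≡⟨ ∑-distrib-+ f′ g′ ⟩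
    sum f′ + sum g′               ∎
    where open ≡-Reasoning

  applies-balance : ∀ {N} {ρ : Reaction N} {x y} → Applies ρ x y →
                    ∀ s → y s + reactants ρ s ≡ x s + products ρ s
  applies-balance {ρ = ρ} {x} {y} (applicable , result) s = begin
    y s + a              ≡⟨ cong (_+ a) (result s) ⟩
    x s ∸ a + p + a      ≡⟨ xy∙z≈xz∙y (x s ∸ a) p a ⟩
    x s ∸ a + a + p      ≡⟨ cong (_+ p) (ℕP.m∸n+n≡m (applicable s)) ⟩
    x s + p              ∎
    where
    open ≡-Reasoning
    a p : ℕ
    a = reactants ρ s
    p = products ρ s

module _ where
  open import Data.Nat using () renaming (_+_ to _+ℕ_)
  open import Data.Integer using (_+_; _*_; _-_; -_; ∣_∣)
  open import Algebra.Properties.CommutativeSemigroup ℤP.+-commutativeSemigroup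
    using (interchange)

  weightedSum-cong : ∀ {N} (v : Fin N → ℤ) {f g : Fin N → ℕ} → (∀ i → f i ≡ g i) →
                     weightedSum v f ≡ weightedSum v g
  weightedSum-cong {zero}  v eq = refl
  weightedSum-cong {suc N} v eq =
    cong₂ (λ a b → v zero * + a + b) (eq zero) (weightedSum-cong (v ∘ suc) (eq ∘ suc))

  weightedSum-zero : ∀ {N} (v : Fin N → ℤ) → weightedSum v (λ _ → 0) ≡ + 0
  weightedSum-zero {zero}  v = refl
  weightedSum-zero {suc N} v = cong₂ _+_ (ℤP.*-zeroʳ (v zero)) (weightedSum-zero (v ∘ suc))

  weightedSum-δ : ∀ {N} (v : Fin N → ℤ) (i : Fin N) → weightedSum v (δ i) ≡ v i
  weightedSum-δ v zero    =
    trans (cong₂ _+_ (ℤP.*-identityʳ (v zero)) (weightedSum-zero (v ∘ suc))) (ℤP.+-identityʳ (v zero))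
  weightedSum-δ v (suc i) =
    trans (cong₂ _+_ (ℤP.*-zeroʳ (v zero)) (weightedSum-δ (v ∘ suc) i)) (ℤP.+-identityˡ (v (suc i)))

  weightedSum-+ : ∀ {N} (v : Fin N → ℤ) (f g : Fin N → ℕ) →
                  weightedSum v (λ i → f i +ℕ g i) ≡ weightedSum v f + weightedSum v g
  weightedSum-+ {zero}  v f g = refl
  weightedSum-+ {suc N} v f g = begin
    v₀ * + (f zero +ℕ g zero) + weightedSum v′ (λ i → f (suc i) +ℕ g (suc i))
      ≡⟨ cong₂ _+_ (trans (cong (v₀ *_) (ℤP.pos-+ (f zero) (g zero))) (ℤP.*-distribˡ-+ v₀ _ _))
                   (weightedSum-+ v′ (f ∘ suc) (g ∘ suc)) ⟩
    (v₀ * + f zero + v₀ * + g zero) + (weightedSum v′ (f ∘ suc) + weightedSum v′ (g ∘ suc))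
      ≡⟨ interchange (v₀ * + f zero) (v₀ * + g zero) _ _ ⟩
    weightedSum v f + weightedSum v g ∎
    where
    open ≡-Reasoning
    v₀ : ℤ
    v₀ = v zero
    v′ : Fin N → ℤ
    v′ = v ∘ suc

  weightedSum-balance : ∀ {N} (v : Fin N → ℤ) {f g f′ g′ : Fin N → ℕ} →
                        (∀ i → f i +ℕ g i ≡ f′ i +ℕ g′ i) →
                        weightedSum v f + weightedSum v g ≡ weightedSum v f′ + weightedSum v g′
  weightedSum-balance v {f} {g} {f′} {g′} eq = begin
    weightedSum v f + weightedSum v g            ≡⟨ weightedSum-+ v f g ⟨
    weightedSum v (λ i → f i +ℕ g i)            ≡⟨ weightedSum-cong v eq ⟩
    weightedSum v (λ i → f′ i +ℕ g′ i)          ≡⟨ weightedSum-+ v f′ g′ ⟩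
    weightedSum v f′ + weightedSum v g′          ∎
    where open ≡-Reasoning

  -- A record rather than a synonym, so that a, b and m can be inferred from the type.
  infix 4 _≡_mod_
  record _≡_mod_ (a b : ℤ) (m : ℕ) : Set where
    constructor congruent
    field divides-difference : + m ∣ a - b
  open _≡_mod_ public

  module _ {m : ℕ} where
    ≡⇒≡-mod : ∀ {a b} → a ≡ b → a ≡ b mod m
    ≡⇒≡-mod {a} refl = congruent (divides (+ 0) (ℤP.+-inverseʳ a))

    ≡-mod-sym : ∀ {a b} → a ≡ b mod m → b ≡ a mod m
    ≡-mod-sym {a} {b} (congruent m∣a-b) =
      congruent (subst (+ m ∣_) (identity a b) (∣m⇒∣-m m∣a-b))
      where
      identity : ∀ a b → - (a - b) ≡ b - a
      identity = solve-∀

    ≡-mod-trans : ∀ {a b c} → a ≡ b mod m → b ≡ c mod m → a ≡ c mod m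
    ≡-mod-trans {a} {b} {c} (congruent m∣a-b) (congruent m∣b-c) =
      congruent (subst (+ m ∣_) (identity a b c) (∣m∣n⇒∣m+n m∣a-b m∣b-c))
      where
      identity : ∀ a b c → (a - b) + (b - c) ≡ a - c
      identity = solve-∀

    ≡-mod-cancel : ∀ {a b c d} → a + b ≡ c + d → b ≡ d mod m → a ≡ c mod m
    ≡-mod-cancel {a} {b} {c} {d} eq (congruent m∣b-d) =
      congruent (subst (+ m ∣_) (identity a b c d) (∣m∣n⇒∣m+n (∣m⇒∣-m m∣b-d) m∣a+b-[c+d]))
      where
      m∣a+b-[c+d] : + m ∣ (a + b) - (c + d)
      m∣a+b-[c+d] = divides-difference (≡⇒≡-mod eq)
      identity : ∀ a b c d → - (b - d) + ((a + b) - (c + d)) ≡ a - c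
      identity = solve-∀

    ≡-mod-%ℕ : .{{_ : NonZero m}} → ∀ a → a ≡ + (a %ℕ m) mod m
    ≡-mod-%ℕ a = congruent (divides (a /ℕ m) (begin
      a - r                      ≡⟨ cong (_- r) (a≡a%ℕn+[a/ℕn]*n a m) ⟩
      (r + a /ℕ m * + m) - r     ≡⟨ identity r (a /ℕ m * + m) ⟩
      a /ℕ m * + m               ∎))
      where
      open ≡-Reasoning
      r : ℤ
      r = + (a %ℕ m)
      identity : ∀ r q → (r + q) - r ≡ q
      identity = solve-∀

    toℕ-mod-injective : .{{_ : NonZero m}} → ∀ {r c : Fin m} →
                        + toℕ r ≡ + toℕ c mod m → r ≡ c
    toℕ-mod-injective {r} {c} (congruent m∣r-c) =
      toℕ-injective (ℤP.+-injective (ℤP.i-j≡0⇒i≡j _ _ (ℤP.∣i∣≡0⇒i≡0 ∣r-c∣≡0)))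
      where
      ∣r-c∣<m : ∣ + toℕ r - + toℕ c ∣ < m
      ∣r-c∣<m = ℕP.≤-<-trans (ℕP.≤-reflexive (cong ∣_∣ (ℤP.m-n≡m⊖n (toℕ r) (toℕ c))))
                (ℕP.≤-<-trans (ℤP.∣m⊝n∣≤m⊔n (toℕ r) (toℕ c))
                              (ℕP.⊔-lub (toℕ<n r) (toℕ<n c)))
      ∣r-c∣≡0 : ∣ + toℕ r - + toℕ c ∣ ≡ 0
      ∣r-c∣≡0 = trans (sym (m<n⇒m%n≡m ∣r-c∣<m)) (n∣m⇒m%n≡0 _ m (∣⇒∣ᵤ m∣r-c))

module _ {N : ℕ} where
  voter-present : (V : Subset N) {o : Fin N → ℕ} {s₀ : Fin N} →
                  (∀ s → 0 < o s → s ≡ s₀) → 0 < o s₀ →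
                  does (any? λ s → (s ∈? V) ×-dec (0 <? o s)) ≡ does (s₀ ∈? V)
  voter-present V {o} {s₀} only pos with s₀ ∈? V
  ... | yes s₀∈V = dec-true (any? λ s → (s ∈? V) ×-dec (0 <? o s)) (s₀ , s₀∈V , pos)
  ... | no  s₀∉V = dec-false (any? λ s → (s ∈? V) ×-dec (0 <? o s))
                     λ (s , s∈V , s-pos) → s₀∉V (subst (_∈ V) (only s s-pos) s∈V)

  does-∈?-∁ : (x : Fin N) (p : Subset N) → does (x ∈? ∁ p) ≡ not (does (x ∈? p))
  does-∈?-∁ x p with x ∈? p
  ... | yes x∈p = dec-false (x ∈? ∁ p) (x∈p⇒x∉∁p x∈p)
  ... | no  x∉p = dec-true  (x ∈? ∁ p) (x∉p⇒x∈∁p x∉p)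

module _ {k : ℕ} (D : CRD k) where
  open CRD D

  Φ-decided : ∀ {o} b → someYes D o ≡ b → someNo D o ≡ not b → Φ D o ≡ just b
  Φ-decided true  yes≡ no≡ rewrite yes≡ | no≡ = refl
  Φ-decided false yes≡ no≡ rewrite yes≡ | no≡ = refl

  Φ-single-species : noVoters ≡ ∁ yesVoters → ∀ {o s₀} →
                     (∀ s → 0 < o s → s ≡ s₀) → 0 < o s₀ → Φ D o ≡ just (does (s₀ ∈? yesVoters))
  Φ-single-species no≡∁yes {s₀ = s₀} only pos = Φ-decided _
    (voter-present yesVoters only pos)
    (trans (voter-present noVoters only pos)
           (trans (cong (does ∘ (s₀ ∈?_)) no≡∁yes) (does-∈?-∁ s₀ yesVoters)))

module ModCounter (k : ℕ) (w : Fin k → ℤ) (m′ : ℕ) (c : Fin (suc m′)) where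
  open import Data.Nat using (_∸_) renaming (_+_ to _+ℕ_)
  open import Data.Integer using (_+_)

  m n : ℕ
  m = suc m′
  n = k +ℕ m

  X : Fin k → Fin n
  X j = j ↑ˡ m

  L : Fin m → Fin n
  L r = k ↑ʳ r

  L≢X : ∀ r j → L r ≢ X j
  L≢X r j eq with trans (sym (splitAt-↑ʳ k m r)) (trans (cong (splitAt k) eq) (splitAt-↑ˡ k j m))
  ... | ()

  species-view : ∀ s → (∃[ j ] s ≡ X j) ⊎ (∃[ r ] s ≡ L r)
  species-view s with splitAt k s in eq
  ... | inj₁ j = inj₁ (j , sym (splitAt⁻¹-↑ˡ eq))
  ... | inj₂ r = inj₂ (r , sym (splitAt⁻¹-↑ʳ eq))

  next : Fin m → Fin k → Fin m
  next r j = fromℕ< (n%ℕd<d (w j + + toℕ r) m)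

  fire : Fin m → Fin k → Reaction n
  fire r j = (δ j ++ δ r) ⇒ (replicate k 0 ++ δ (next r j))

  reactions : List (Reaction n)
  reactions = cartesianProductWith fire (allFin m) (allFin k)

  fire∈reactions : ∀ r j → fire r j ∈L reactions
  fire∈reactions r j = ∈-cartesianProductWith⁺ fire (∈-allFin r) (∈-allFin j)

  D : CRD k
  D = record
    { n         = n
    ; reactions = reactions
    ; input     = X
    ; input-inj = λ {i} {j} → ↑ˡ-injective m i j
    ; yesVoters = ⁅ L c ⁆
    ; noVoters  = ∁ ⁅ L c ⁆
    ; context   = replicate k 0 ++ δ zero
    }

  leaderWeight : Fin m → ℤ
  leaderWeight r = + toℕ r

  inputValue leaderValue value : Config n → ℤ
  inputValue x  = weightedSum w (x ∘ X)
  leaderValue x = weightedSum leaderWeight (x ∘ L)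
  value x       = inputValue x + leaderValue x

  LeaderAt : Fin m → Config n → Set
  LeaderAt r x = ∀ i → x (L i) ≡ δ r i

  Invariant : ℤ → Config n → Set
  Invariant W x = ∃[ r ] LeaderAt r x × value x ≡ W mod m

  Inert : Config n → Set
  Inert x = ∀ j → x (X j) ≡ 0

  value-leader : ∀ x {f r} → (∀ j → x (X j) ≡ f j) → LeaderAt r x →
                 value x ≡ weightedSum w f + + toℕ r
  value-leader x {r = r} inputs leader =
    cong₂ _+_ (weightedSum-cong w inputs)
              (trans (weightedSum-cong leaderWeight leader) (weightedSum-δ leaderWeight r))

  restricted-balance : ∀ {N} (e : Fin N → Fin n) (v : Fin N → ℤ) {ρ x y} → Applies ρ x y →
                       weightedSum v (y ∘ e) + weightedSum v (reactants ρ ∘ e)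
                       ≡ weightedSum v (x ∘ e) + weightedSum v (products ρ ∘ e)
  restricted-balance e v {ρ} {x} {y} app =
    weightedSum-balance v {y ∘ e} {reactants ρ ∘ e} {x ∘ e} {products ρ ∘ e} (applies-balance app ∘ e)

  value-balance : ∀ {ρ x y} → Applies ρ x y →
                  value y + value (reactants ρ) ≡ value x + value (products ρ)
  value-balance {ρ} {x} {y} app = begin
    value y + value (reactants ρ)
      ≡⟨ interchange (inputValue y) (leaderValue y) _ _ ⟩
    (inputValue y + inputValue (reactants ρ)) + (leaderValue y + leaderValue (reactants ρ))
      ≡⟨ cong₂ _+_ (restricted-balance X w app) (restricted-balance L leaderWeight app) ⟩
    (inputValue x + inputValue (products ρ)) + (leaderValue x + leaderValue (products ρ))
      ≡⟨ interchange (inputValue x) (inputValue (products ρ)) _ _ ⟩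
    value x + value (products ρ) ∎
    where
    open ≡-Reasoning
    open import Algebra.Properties.CommutativeSemigroup ℤP.+-commutativeSemigroup
      using (interchange)

  record Conservative (ρ : Reaction n) : Set where
    field
      consumed produced : Fin m
      consumes          : LeaderAt consumed (reactants ρ)
      produces          : LeaderAt produced (products ρ)
      value-conserved   : value (reactants ρ) ≡ value (products ρ) mod m

  reverse-conservative : ∀ {ρ} → Conservative ρ → Conservative (reverse ρ)
  reverse-conservative ρ-cons = record
    { consumed = produced ; produced = consumed ; consumes = produces ; produces = consumes
    ; value-conserved = ≡-mod-sym value-conserved }
    where open Conservative ρ-cons

  fire-conservative : ∀ r j → Conservative (fire r j)
  fire-conservative r j = record
    { consumed = r ; produced = next r j
    ; consumes = lookup-++ʳ (δ j) (δ r) ; produces = lookup-++ʳ (replicate k 0) (δ (next r j))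
    ; value-conserved = subst₂ (_≡_mod m) (sym value-consumed) (sym value-produced)
                               (≡-mod-%ℕ (w j + + toℕ r))
    }
    where
    value-consumed : value (reactants (fire r j)) ≡ w j + + toℕ r
    value-consumed =
      trans (value-leader (reactants (fire r j)) (lookup-++ˡ (δ j) (δ r)) (lookup-++ʳ (δ j) (δ r)))
            (cong (_+ + toℕ r) (weightedSum-δ w j))
    value-produced : value (products (fire r j)) ≡ + ((w j + + toℕ r) %ℕ m)
    value-produced = begin
      value (products (fire r j))
        ≡⟨ value-leader (products (fire r j)) (lookup-++ˡ (replicate k 0) (δ (next r j)))
                                              (lookup-++ʳ (replicate k 0) (δ (next r j))) ⟩
      weightedSum w (replicate k 0) + + toℕ (next r j)
        ≡⟨ cong₂ _+_ (weightedSum-zero w) (cong +_ (toℕ-fromℕ< _)) ⟩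
      + ((w j + + toℕ r) %ℕ m) ∎
      where open ≡-Reasoning

  conservative-preserves : ∀ {W ρ x y} → Conservative ρ → Applies ρ x y →
                           Invariant W x → Invariant W y
  conservative-preserves {ρ = ρ} {x} {y} ρ-cons app@(applicable , result) (r , leader , x≡W) =
    produced , moved , ≡-mod-trans (≡-mod-cancel (value-balance app) value-conserved) x≡W
    where
    open Conservative ρ-cons
    r≡consumed : r ≡ consumed
    r≡consumed = δ-pos⇒≡ (subst₂ _≤_ (trans (consumes consumed) (δ-diag consumed)) (leader consumed)
                                     (applicable (L consumed)))
    moved : LeaderAt produced y
    moved i rewrite result (L i) | leader i | consumes i | produces i | r≡consumed =
      cong (_+ℕ δ produced i) (ℕP.n∸n≡0 (δ consumed i))

  revStep-preserves : ∀ {W x y} → RevStep reactions x y → Invariant W x → Invariant W y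
  revStep-preserves (ρ , ρ∈ , app) with ∈-cartesianProductWith⁻ fire (allFin m) (allFin k) ρ∈
  ... | r , j , _ , _ , refl with app
  ...   | inj₁ forward  = conservative-preserves (fire-conservative r j) forward
  ...   | inj₂ backward =
    conservative-preserves (reverse-conservative (fire-conservative r j)) backward

  step-preserves : ∀ {W x y} → Step reactions x y → Invariant W x → Invariant W y
  step-preserves (ρ , ρ∈ , app) = revStep-preserves (ρ , ρ∈ , inj₁ app)

  revReach-preserves : ∀ {W x y} → RevReach reactions x y → Invariant W x → Invariant W y
  revReach-preserves ε              = id
  revReach-preserves (step ◅ steps) = revReach-preserves steps ∘ revStep-preserves step

  count : Config n → ℕ
  count x = sum (x ∘ X)

  fire-step : ∀ x r j → LeaderAt r x → 0 < x (X j) →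
              ∃[ y ] Step reactions x y × suc (count y) ≡ count x
  fire-step x r j leader pos = y , (fire r j , fire∈reactions r j , app) , count-drops
    where
    y : Config n
    y s = x s ∸ reactants (fire r j) s +ℕ products (fire r j) s
    applicable : Applicable (fire r j) x
    applicable s with species-view s
    ... | inj₁ (j′ , refl) =
      subst (_≤ x (X j′)) (sym (lookup-++ˡ (δ j) (δ r) j′)) (δ≤ (x ∘ X) pos j′)
    ... | inj₂ (i , refl)  = ℕP.≤-reflexive (trans (lookup-++ʳ (δ j) (δ r) i) (sym (leader i)))
    app : Applies (fire r j) x y
    app = applicable , λ _ → refl
    count-drops : suc (count y) ≡ count x
    count-drops = begin
      suc (count y)                             ≡⟨ ℕP.+-comm 1 (count y) ⟩
      count y +ℕ 1                              ≡⟨ cong (count y +ℕ_) (sum-δ j) ⟨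
      count y +ℕ sum (δ j)
        ≡⟨ cong (count y +ℕ_) (sum-cong-≗ (lookup-++ˡ (δ j) (δ r))) ⟨
      count y +ℕ sum (reactants (fire r j) ∘ X) ≡⟨ sum-balance (applies-balance app ∘ X) ⟩
      count x +ℕ sum (products (fire r j) ∘ X)
        ≡⟨ cong (count x +ℕ_) (sum-cong-≗ (lookup-++ˡ (replicate k 0) (δ (next r j)))) ⟩
      count x +ℕ sum (replicate k 0)            ≡⟨ cong (count x +ℕ_) (sum-replicate-zero k) ⟩
      count x +ℕ 0                              ≡⟨ ℕP.+-identityʳ (count x) ⟩
      count x                                   ∎
      where open ≡-Reasoning

  drain : ∀ {W} N x → count x ≡ N → Invariant W x →
          ∃[ o ] Reach reactions x o × Invariant W o × Inert o
  drain N x count≡N inv with any? (λ j → 0 <? x (X j))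
  ... | no none = x , ε , inv , λ j → ℕP.n≤0⇒n≡0 (ℕP.≮⇒≥ (λ pos → none (j , pos)))
  drain zero x count≡0 (r , leader , _) | yes (j , pos) with fire-step x r j leader pos
  ... | _ , _ , count-drops = ⊥-elim (ℕP.1+n≢0 (trans count-drops count≡0))
  drain (suc N) x count≡N inv@(r , leader , _) | yes (j , pos) with fire-step x r j leader pos
  ... | y , step , count-drops
      with drain N y (ℕP.suc-injective (trans count-drops count≡N)) (step-preserves step inv)
  ...   | o , y→o , inv′ , inert = o , step ◅ y→o , inv′ , inert

  inert-stable : ∀ {o} → Inert o → Stable D o
  inert-stable inert _ ε = refl
  inert-stable inert _ ((ρ , ρ∈ , applicable , _) ◅ _)
    with ∈-cartesianProductWith⁻ fire (allFin m) (allFin k) ρ∈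
  ... | r , j , _ , _ , refl =
    ⊥-elim (ℕP.n≮n 0 (subst₂ _≤_ (trans (lookup-++ˡ (δ j) (δ r) j) (δ-diag j)) (inert j)
                                 (applicable (X j))))

  inert-output : ∀ o r → Inert o → LeaderAt r o → Φ D o ≡ just (does (r ≟ c))
  inert-output o r inert leader =
    trans (Φ-single-species D refl only-L-r L-r-present)
          (cong just (does-⇔ L-r∈⇔r≡c (L r ∈? ⁅ L c ⁆) (r ≟ c)))
    where
    only-L-r : ∀ s → 0 < o s → s ≡ L r
    only-L-r s pos with species-view s
    ... | inj₁ (j , refl) = ⊥-elim (ℕP.n≮n 0 (subst (0 <_) (inert j) pos))
    ... | inj₂ (i , refl) = cong L (sym (δ-pos⇒≡ (subst (0 <_) (leader i) pos)))
    L-r-present : 0 < o (L r)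
    L-r-present = ℕP.≤-reflexive (sym (trans (leader r) (δ-diag r)))
    L-r∈⇔r≡c : L r ∈ ⁅ L c ⁆ ⇔ r ≡ c
    L-r∈⇔r≡c = mk⇔ (↑ʳ-injective k r c ∘ x∈⁅y⁆⇒x≡y (L c)) (λ { refl → x∈⁅x⁆ (L r) })

  value-inert : ∀ o r → Inert o → LeaderAt r o → value o ≡ + toℕ r
  value-inert o r inert leader =
    trans (value-leader o inert leader)
          (trans (cong (_+ + toℕ r) (weightedSum-zero w)) (ℤP.+-identityˡ _))

  init-invariant : ∀ {x i} → ValidInit D x i → Invariant (weightedSum w x) i
  init-invariant {x} {i} (inputs , others) =
    zero , leader , ≡⇒≡-mod (trans (value-leader i inputs leader) (ℤP.+-identityʳ _))
    where
    leader : LeaderAt zero i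
    leader r = trans (others (L r) (L≢X r)) (lookup-++ʳ (replicate k 0) (δ zero) r)

  decides : ReverseRobustlyDecides D (ModSet w m (toℕ c))
  decides x i valid y i↬y with drain _ y refl (revReach-preserves i↬y (init-invariant valid))
  ... | o , y→o , (r , leader , o≡W) , inert = o , y→o , inert-stable inert , accept , reject
    where
    r≡W : + toℕ r ≡ weightedSum w x mod m
    r≡W = subst (_≡ weightedSum w x mod m) (value-inert o r inert leader) o≡W
    accept : ModSet w m (toℕ c) x → Φ D o ≡ just true
    accept x∈S = trans (inert-output o r inert leader) (cong just (dec-true (r ≟ c) r≡c))
      where
      r≡c : r ≡ c
      r≡c = toℕ-mod-injective (≡-mod-trans r≡W (congruent (∣ᵤ⇒∣ x∈S)))
    reject : ¬ ModSet w m (toℕ c) x → Φ D o ≡ just false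
    reject x∉S = trans (inert-output o r inert leader) (cong just (dec-false (r ≟ c) r≢c))
      where
      r≢c : r ≢ c
      r≢c refl = x∉S (∣⇒∣ᵤ (divides-difference (≡-mod-sym r≡W)))

lemma7 : (k : ℕ) (w : Fin k → ℤ) (m : ℕ) (c : ℕ) → 0 < m → c < m →
         ∃[ D ] ReverseRobustlyDecides {k} D (ModSet w m c)
lemma7 k w zero     c () _
lemma7 k w (suc m′) c _  c<m =
  D , subst (ReverseRobustlyDecides D ∘ ModSet w (suc m′)) (toℕ-fromℕ< c<m) decides
  where open ModCounter k w m′ (fromℕ< c<m)
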